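{- Let $\mathcal C(\Lambda_1)=\{c_M=(\mathrm{Tr}(X_1M),\dots,\mathrm{Tr}(X_NM)):M\in M_{n+1}(q)\}$ be the code associated to the projective system $\Lambda_1=\{[X_1],\dots,[X_N]\}$ of all points $[x\xi]\in\mathrm{PG}(M_{n+1}(q))$ with $x$ a nonzero column vector, $\xi$ a nonzero row vector, $\xi x=0$. The maximum weight codewords of $\mathcal C(\Lambda_1)$ have weight $q^{n-1}(q^{n+1}-1)/(q-1)$ and correspond to the hyperplanes $[M^{\perp_f}]$ where $M$ has no eigenvalues in $\mathbb F_q$; that is, $c_M$ has maximum weight if and only if $M$ has no eigenvalue in $\mathbb F_q$.
   Context: $M^{\perp_f}=\{X\in M_{n+1}(q):\mathrm{Tr}(XM)=0\}$; the zero coordinates of $c_M$ are the points of $\Lambda_1\cap[M^{\perp_f}]$. -}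

module Defs where

open import Level using (0ℓ)
open import Algebra.Bundles using (CommutativeRing)
open import Data.Nat using (ℕ; zero; suc)
open import Data.Fin using (Fin; zero; suc)
open import Data.List using (List; length)
open import Data.List.Relation.Unary.Any using (Any)
open import Data.List.Relation.Unary.All using (All)
open import Data.List.Relation.Unary.AllPairs using (AllPairs)
open import Data.Product using (Σ; ∃; ∃₂; _×_)
open import Relation.Nullary using (¬_)
open import Relation.Binary.PropositionalEquality using (_≡_)
open import Relation.Binary using (Decidable)

record FiniteField : Set₁ where
  field
    ring : CommutativeRing 0ℓ 0ℓ
  open CommutativeRing ring
  field
    _≟_      : Decidable _≈_
    0≉1      : ¬ (0# ≈ 1#)
    inverse  : ∀ x → ¬ (x ≈ 0#) → ∃ λ y → (x * y) ≈ 1#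
    elements : List Carrier
    complete : ∀ x → Any (x ≈_) elements
    distinct : AllPairs (λ a b → ¬ (a ≈ b)) elements

  q : ℕ
  q = length elements

module _ (F : FiniteField) where
  open FiniteField F
  open CommutativeRing ring using (Carrier; _≈_; _+_; _*_; 0#; 1#)

  Vect : ℕ → Set
  Vect k = Fin k → Carrier

  Mat : ℕ → Set
  Mat k = Fin k → Fin k → Carrier

  sumF : ∀ {k} → (Fin k → Carrier) → Carrier
  sumF {zero}  f = 0#
  sumF {suc k} f = f zero + sumF (λ i → f (suc i))

  NonZeroVec : ∀ {k} → Vect k → Set
  NonZeroVec v = ∃ λ i → ¬ (v i ≈ 0#)

  NonZeroMat : ∀ {k} → Mat k → Set
  NonZeroMat X = ∃₂ λ i j → ¬ (X i j ≈ 0#)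

  _≈ₘ_ : ∀ {k} → Mat k → Mat k → Set
  A ≈ₘ B = ∀ i j → A i j ≈ B i j

  _·ₘ_ : ∀ {k} → Mat k → Mat k → Mat k
  (A ·ₘ B) i j = sumF (λ l → A i l * B l j)

  Tr : ∀ {k} → Mat k → Carrier
  Tr A = sumF (λ i → A i i)

  _•ₘ_ : ∀ {k} → Carrier → Mat k → Mat k
  (c •ₘ A) i j = c * A i j

  outer : ∀ {k} → Vect k → Vect k → Mat k
  outer x ξ i j = x i * ξ j

  rowCol : ∀ {k} → Vect k → Vect k → Carrier
  rowCol ξ x = sumF (λ i → ξ i * x i)

  InΛ₁ : ∀ {k} → Mat k → Set
  InΛ₁ X = ∃₂ λ x ξ → NonZeroVec x × NonZeroVec ξ × (rowCol ξ x ≈ 0#)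
                     × (X ≈ₘ outer x ξ)

  SamePoint : ∀ {k} → Mat k → Mat k → Set
  SamePoint X Y = ∃ λ c → ¬ (c ≈ 0#) × (X ≈ₘ (c •ₘ Y))

  NonZeroCoord : ∀ {k} → Mat k → Mat k → Set
  NonZeroCoord M X = ¬ (Tr (X ·ₘ M) ≈ 0#)

  -- Weight M w : the codeword c_M of C(Λ₁) has Hamming weight w, i.e.
  -- exactly w points [X] of Λ₁ have Tr(X M) ≠ 0.  Counted via a list of
  -- representatives, one for each such projective point.
  Weight : ∀ {k} → Mat k → ℕ → Set
  Weight {k} M w = Σ (List (Mat k)) λ L →
      (length L ≡ w)
    × All (λ X → NonZeroMat X × InΛ₁ X × NonZeroCoord M X) L
    × AllPairs (λ X Y → ¬ SamePoint X Y) L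
    × (∀ X → NonZeroMat X → InΛ₁ X → NonZeroCoord M X → Any (SamePoint X) L)

  HasEigenvalue : ∀ {k} → Mat k → Set
  HasEigenvalue M = ∃₂ λ (λ₀ : Carrier) (v : Vect _) →
    NonZeroVec v × (∀ i → sumF (λ j → M i j * v j) ≈ (λ₀ * v i))

{-# OPTIONS --safe #-}
-- Count the pairs (x, ξ) of a nonzero column vector x and a row vector ξ with ξx = 0 and
-- ξMx ≠ 0 in two ways.  Every point [xξ] of Λ₁ at which c_M is nonzero is represented by
-- exactly (q - 1)² such pairs, so there are w(q - 1)² of them.  For fixed x there are none
-- when x is an eigenvector of M; otherwise x and Mx are independent, ξ ↦ (ξx, ξMx) maps
-- onto F_q² with fibres of equal size q^(n-1), and there are (q - 1)q^(n-1) of them.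
-- Summing over the q^(n+1) - 1 nonzero x gives w(q - 1)² ≤ (q^(n+1) - 1)(q - 1)q^(n-1),
-- with equality exactly when M has no eigenvector.  Such an M exists: the companion matrix
-- of t^(n+1) - t - c for a value c missed by t ↦ t^(n+1) - t, which is not injective since
-- it vanishes at 0 and at 1.
module Submission where

open import Defs
open import Data.Nat using (ℕ; suc)

module Counting where

  open import Level using (0ℓ)
  open import Data.Nat using (_+_; _*_; _∸_; _≤_; z≤n; s≤s)
  open import Data.Nat.Properties
    using (≤-antisym; ≤-trans; ≤-reflexive; <-irrefl; m+n∸m≡n; +-mono-≤; +-monoʳ-≤; +-cancelʳ-≤;
           +-cancelˡ-≡)
  open import Data.Nat.ListAction using (sum)
  open import Data.Empty using (⊥-elim)
  open import Data.Unit using (⊤; tt)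
  open import Data.Sum using (_⊎_; inj₁; inj₂; [_,_])
  open import Data.Product using (∃; _×_; _,_; proj₁; proj₂)
  open import Data.Product.Relation.Binary.Pointwise.NonDependent using (_×ₛ_)
  open import Data.List using (List; []; _∷_; length; map; filter; deduplicate; _++_)
  open import Data.List.Properties using (length-++; length-map; length-removeAt′)
  open import Data.List.Relation.Unary.Any as Any using (Any; here; there; index)
  open import Data.List.Relation.Unary.All as All using (All; []; _∷_)
  open import Data.List.Relation.Unary.All.Properties
    using (All¬⇒¬Any; ¬All⇒Any¬; all-filter; filter⁺; ++⁺; map⁺)
  open import Data.List.Relation.Unary.AllPairs using ([]; _∷_)
  import Data.List.Relation.Unary.Unique.Setoid as UniqueSetoid
  import Data.List.Relation.Unary.Unique.Setoid.Properties as Unique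
  open import Data.List.Relation.Unary.Unique.DecSetoid.Properties using (deduplicate-!)
  import Data.List.Membership.Setoid as Membership
  open import Data.List.Membership.Setoid.Properties
    using (∈-resp-≈; ∈-map⁺; ∈-filter⁺; ∈-deduplicate⁺; ∈-++⁺ˡ; ∈-++⁺ʳ)
  open import Function using (_∘_)
  open import Relation.Binary using (Setoid; DecSetoid; _Respects_)
  open import Relation.Binary.PropositionalEquality as ≡ using (_≡_)
  open import Relation.Nullary using (¬_; Dec; yes; no; ¬?)
  open import Relation.Unary using (Pred; Decidable; ∁)

  module _ (S : Setoid 0ℓ 0ℓ) where
    open Setoid S renaming (Carrier to A)
    open Membership S using (_∈_; _─_)
    open UniqueSetoid S using (Unique)

    record Census (P : Pred A 0ℓ) (m : ℕ) : Set where
      field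
        members        : List A
        length-members : length members ≡ m
        sound          : All P members
        unique         : Unique members
        complete       : ∀ {x} → P x → x ∈ members

    open Census

    ∈-─⁺ : ∀ {x y ys} (x∈ys : x ∈ ys) → y ∈ ys → ¬ y ≈ x → y ∈ ys ─ x∈ys
    ∈-─⁺ (here x≈z)   (here y≈z)   y≉x = ⊥-elim (y≉x (trans y≈z (sym x≈z)))
    ∈-─⁺ (here _)     (there y∈ys) _   = y∈ys
    ∈-─⁺ (there _)    (here y≈z)   _   = here y≈z
    ∈-─⁺ (there x∈ys) (there y∈ys) y≉x = there (∈-─⁺ x∈ys y∈ys y≉x)

    unique-length-≤ : ∀ {xs ys} → Unique xs → (∀ {x} → x ∈ xs → x ∈ ys) → length xs ≤ length ys
    unique-length-≤ {[]}     []            _     = z≤n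
    unique-length-≤ {x ∷ xs} {ys} (x∉xs ∷ xs!) xs⊆ys =
      ≡.subst (suc (length xs) ≤_) (≡.sym (length-removeAt′ ys (index x∈ys)))
        (s≤s (unique-length-≤ xs! xs⊆ys─x))
      where
      x∈ys : x ∈ ys
      x∈ys = xs⊆ys (here refl)
      xs⊆ys─x : ∀ {y} → y ∈ xs → y ∈ ys ─ x∈ys
      xs⊆ys─x y∈xs = ∈-─⁺ x∈ys (xs⊆ys (there y∈xs))
        (λ y≈x → All¬⇒¬Any x∉xs (∈-resp-≈ S y≈x y∈xs))

    members-⊆ : ∀ {P m n} (c : Census P m) (d : Census P n) {x} → x ∈ members c → x ∈ members d
    members-⊆ c d x∈c with All.lookupAny (sound c) x∈c
    ... | Pz , x≈z = ∈-resp-≈ S (sym x≈z) (complete d Pz)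

    census-unique : ∀ {P m n} → Census P m → Census P n → m ≡ n
    census-unique {m = m} {n} c d = begin
      m                ≡⟨ ≡.sym (length-members c) ⟩
      length (members c) ≡⟨ ≤-antisym (unique-length-≤ (unique c) (members-⊆ c d))
                                      (unique-length-≤ (unique d) (members-⊆ d c)) ⟩
      length (members d) ≡⟨ length-members d ⟩
      n                ∎
      where open ≡.≡-Reasoning

    census-cong : ∀ {P Q m} → (∀ {x} → P x → Q x) → (∀ {x} → Q x → P x) → Census P m → Census Q m
    census-cong P⇒Q Q⇒P c = record
      { members        = members c
      ; length-members = length-members c
      ; sound          = All.map P⇒Q (sound c)
      ; unique         = unique c
      ; complete       = λ qx → complete c (Q⇒P qx)
      }

    census-∅ : ∀ {P} → (∀ {x} → ¬ P x) → Census P 0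
    census-∅ ¬P = record
      { members = [] ; length-members = ≡.refl ; sound = [] ; unique = [] ; complete = λ px → ⊥-elim (¬P px) }

    census-≈ : ∀ z → Census (_≈ z) 1
    census-≈ z = record
      { members = z ∷ [] ; length-members = ≡.refl ; sound = refl ∷ [] ; unique = [] ∷ [] ; complete = here }

    census-∪ : ∀ {P Q m n} → Census P m → Census Q n → (∀ {x y} → P x → Q y → ¬ x ≈ y) →
               Census (λ x → P x ⊎ Q x) (m + n)
    census-∪ c d P#Q = record
      { members        = members c ++ members d
      ; length-members = ≡.trans (length-++ (members c)) (≡.cong₂ _+_ (length-members c) (length-members d))
      ; sound          = ++⁺ (All.map inj₁ (sound c)) (All.map inj₂ (sound d))
      ; unique         = Unique.++⁺ S (unique c) (unique d) disjoint
      ; complete       = λ { (inj₁ px) → ∈-++⁺ˡ S (complete c px)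
                           ; (inj₂ qx) → ∈-++⁺ʳ S (members c) (complete d qx) }
      }
      where
      disjoint : ∀ {v} → ¬ (v ∈ members c × v ∈ members d)
      disjoint (v∈c , v∈d) with All.lookupAny (sound c) v∈c | All.lookupAny (sound d) v∈d
      ... | Py , v≈y | Qz , v≈z = P#Q Py Qz (trans (sym v≈y) v≈z)

    module _ {N} (everything : Census (λ _ → ⊤) N) where

      census-filter : ∀ {P : Pred A 0ℓ} → Decidable P → P Respects _≈_ → ∃ (Census P)
      census-filter P? resp = _ , record
        { members        = filter P? (members everything)
        ; length-members = ≡.refl
        ; sound          = all-filter P? (members everything)
        ; unique         = Unique.filter⁺ S P? (unique everything)
        ; complete       = ∈-filter⁺ S P? resp (complete everything tt)
        }

      census-∁ : ∀ {P m} → Decidable P → P Respects _≈_ → Census P m → Census (∁ P) (N ∸ m)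
      census-∁ {P} {m} P? resp c with census-filter (¬? ∘ P?) (λ x≈y ¬Px Py → ¬Px (resp (sym x≈y) Py))
      ... | m′ , c′ = ≡.subst (Census (∁ P)) m′≡N∸m c′
        where
        m+m′≡N : m + m′ ≡ N
        m+m′≡N = census-unique (census-cong (λ _ → tt) (λ {x} _ → P-or-∁P x)
          (census-∪ c c′ (λ Px ¬Py x≈y → ¬Py (resp x≈y Px)))) everything
          where
          P-or-∁P : ∀ x → P x ⊎ ∁ P x
          P-or-∁P x with P? x
          ... | yes Px = inj₁ Px
          ... | no ¬Px = inj₂ ¬Px
        m′≡N∸m : m′ ≡ N ∸ m
        m′≡N∸m = ≡.trans (≡.sym (m+n∸m≡n m m′)) (≡.cong (_∸ m) m+m′≡N)

      census-∃? : ∀ {P : Pred A 0ℓ} → Decidable P → P Respects _≈_ → Dec (∃ P)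
      census-∃? P? resp with Any.any? P? (members everything)
      ... | yes p = yes (Any.satisfied p)
      ... | no ¬p = no λ (x , Px) → ¬p (Any.map (λ x≈y → resp x≈y Px) (complete everything tt))

  All⇒sum-map-≡ : ∀ {A : Set} {f : A → ℕ} {c} xs → All (λ x → f x ≡ c) xs → sum (map f xs) ≡ length xs * c
  All⇒sum-map-≡ []       []           = ≡.refl
  All⇒sum-map-≡ (x ∷ xs) (fx≡c ∷ fxs≡c) = ≡.cong₂ _+_ fx≡c (All⇒sum-map-≡ xs fxs≡c)

  sum-map-const : ∀ {A : Set} s (xs : List A) → sum (map (λ _ → s) xs) ≡ length xs * s
  sum-map-const s xs = All⇒sum-map-≡ xs (All.universal (λ _ → ≡.refl) xs)

  module _ {A : Set} {f : A → ℕ} {c} (f≤c : ∀ x → f x ≤ c) where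

    sum-map-≤ : ∀ xs → sum (map f xs) ≤ length xs * c
    sum-map-≤ []       = z≤n
    sum-map-≤ (x ∷ xs) = +-mono-≤ (f≤c x) (sum-map-≤ xs)

    sum-map-≡⇒All : ∀ xs → sum (map f xs) ≡ length xs * c → All (λ x → f x ≡ c) xs
    sum-map-≡⇒All []       _ = []
    sum-map-≡⇒All (x ∷ xs) sum≡ =
      fx≡c ∷ sum-map-≡⇒All xs (+-cancelˡ-≡ c _ _ (≡.subst (λ a → a + _ ≡ _) fx≡c sum≡))
      where
      fx≡c : f x ≡ c
      fx≡c = ≤-antisym (f≤c x) (+-cancelʳ-≤ (length xs * c) c (f x)
        (≤-trans (≤-reflexive (≡.sym sum≡)) (+-monoʳ-≤ (f x) (sum-map-≤ xs))))

  module _ {S T : Setoid 0ℓ 0ℓ} where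
    open Setoid S using () renaming (Carrier to A; _≈_ to _≈ₛ_)
    open Setoid T renaming (Carrier to B)
    open Membership T using (_∈_)
    open UniqueSetoid T using (Unique)
    open Census

    census-map : ∀ {PA PB m} (h : A → B) →
                 (∀ {x y} → x ≈ₛ y → h x ≈ h y) → (∀ {x y} → h x ≈ h y → x ≈ₛ y) →
                 (∀ {a} → PA a → PB (h a)) → (∀ {b} → PB b → ∃ λ a → PA a × b ≈ h a) →
                 Census S PA m → Census T PB m
    census-map h h-cong h-inj PA⇒PB PB⇒PA c = record
      { members        = map h (members c)
      ; length-members = ≡.trans (length-map h (members c)) (length-members c)
      ; sound          = map⁺ (All.map PA⇒PB (sound c))
      ; unique         = Unique.map⁺ S T h-inj (unique c)
      ; complete       = λ PBb → let (a , PAa , b≈ha) = PB⇒PA PBb in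
                           ∈-resp-≈ T (sym b≈ha) (∈-map⁺ S T h-cong (complete c PAa))
      }

    module _ {PA : Pred A 0ℓ} {PB : Pred B 0ℓ} (f : A → B)
             (f-cong : ∀ {x y} → x ≈ₛ y → f x ≈ f y) (PA⇒PB : ∀ {a} → PA a → PB (f a)) where

      census-Σ : ∀ {mB} {s : B → ℕ} → (∀ {b} → PB b → Census S (λ a → PA a × f a ≈ b) (s b)) →
                 (cB : Census T PB mB) → Census S PA (sum (map s (members cB)))
      census-Σ {s = s} fibre cB =
        census-cong S proj₁ (λ PAa → PAa , complete cB (PA⇒PB PAa)) (over (members cB) (unique cB) (sound cB))
        where
        over : ∀ bs → Unique bs → All PB bs → Census S (λ a → PA a × f a ∈ bs) (sum (map s bs))
        over []       _            _          = census-∅ S (λ { (_ , ()) })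
        over (b ∷ bs) (b∉bs ∷ bs!) (PBb ∷ PBbs) =
          census-cong S [ (λ (PAa , fa≈b) → PAa , here fa≈b) , (λ (PAa , fa∈bs) → PAa , there fa∈bs) ]
                        (λ { (PAa , here fa≈b)    → inj₁ (PAa , fa≈b)
                           ; (PAa , there fa∈bs) → inj₂ (PAa , fa∈bs) })
            (census-∪ S (fibre PBb) (over bs bs! PBbs) apart)
          where
          apart : ∀ {x y} → PA x × f x ≈ b → PA y × f y ∈ bs → ¬ x ≈ₛ y
          apart (_ , fx≈b) (_ , fy∈bs) x≈y =
            All¬⇒¬Any b∉bs (∈-resp-≈ T (trans (sym (f-cong x≈y)) fx≈b) fy∈bs)

      census-Σ-const : ∀ {mB s} → (∀ {b} → PB b → Census S (λ a → PA a × f a ≈ b) s) →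
                       Census T PB mB → Census S PA (mB * s)
      census-Σ-const {s = s} fibre cB = ≡.subst (Census S PA)
        (≡.trans (sum-map-const s (members cB)) (≡.cong (_* s) (length-members cB)))
        (census-Σ fibre cB)

  module _ {S T : Setoid 0ℓ 0ℓ} where
    open Setoid S using () renaming (Carrier to A; refl to reflₛ)
    open Setoid T using () renaming (Carrier to B; refl to reflₜ)

    census-× : ∀ {P Q m n} → Census S P m → Census T Q n →
               Census (S ×ₛ T) (λ (a , b) → P a × Q b) (m * n)
    census-× {P} {Q} cP cQ = census-Σ-const proj₁ proj₁ proj₁ fibre cP
      where
      fibre : ∀ {a} → P a → Census (S ×ₛ T) (λ (x , y) → (P x × Q y) × Setoid._≈_ S x a) _
      fibre {a} Pa = census-map (a ,_) (reflₛ ,_) proj₂ (λ Qb → (Pa , Qb) , reflₛ)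
        (λ { {x , y} ((_ , Qy) , x≈a) → y , Qy , x≈a , reflₜ }) cQ

  module _ (D : DecSetoid 0ℓ 0ℓ) where
    open DecSetoid D renaming (Carrier to A)
    open Membership setoid using (_∈_; _─_)
    open Census

    all-deduplicate : ∀ {P : Pred A 0ℓ} {xs} → All P xs → All P (deduplicate _≟_ xs)
    all-deduplicate []         = []
    all-deduplicate (Px ∷ Pxs) = Px ∷ filter⁺ _ (all-deduplicate Pxs)

    census-deduplicate : ∀ {P : Pred A 0ℓ} xs → All P xs → (∀ {x} → P x → x ∈ xs) → ∃ (Census setoid P)
    census-deduplicate xs Pxs cover = _ , record
      { members        = deduplicate _≟_ xs
      ; length-members = ≡.refl
      ; sound          = all-deduplicate Pxs
      ; unique         = deduplicate-! D xs
      ; complete       = λ Px → ∈-deduplicate⁺ setoid _≟_ (λ z≈y x≈y → trans x≈y (sym z≈y)) (cover Px)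
      }

    module _ {N} (everything : Census setoid (λ _ → ⊤) N)
             (f : A → A) (f-cong : ∀ {x y} → x ≈ y → f x ≈ f y) where

      private
        Hit : Pred A 0ℓ
        Hit v = ∃ λ t → f t ≈ v

        hit? : Decidable Hit
        hit? v = census-∃? setoid everything (λ t → f t ≟ v)
                   (λ t≈t′ ft≈v → trans (f-cong (sym t≈t′)) ft≈v)

        L : List A
        L = members everything

        non-injective⇒not-all-hit : ∀ {a b} → ¬ a ≈ b → f a ≈ f b → ¬ All Hit L
        non-injective⇒not-all-hit {a} {b} a≉b fa≈fb all-hit = <-irrefl ≡.refl
          (≡.subst (_≤ length rest) (length-removeAt′ L (index b∈L))
            (≤-trans (unique-length-≤ setoid (unique everything) L⊆f[rest]) (≤-reflexive (length-map f rest))))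
          where
          b∈L : b ∈ L
          b∈L = complete everything tt
          rest : List A
          rest = L ─ b∈L
          f-rest : ∀ t → f t ∈ map f rest
          f-rest t with t ≟ b
          ... | yes t≈b = ∈-resp-≈ setoid (trans fa≈fb (sym (f-cong t≈b)))
                            (∈-map⁺ setoid setoid f-cong (∈-─⁺ setoid b∈L (complete everything tt) a≉b))
          ... | no t≉b  = ∈-map⁺ setoid setoid f-cong (∈-─⁺ setoid b∈L (complete everything tt) t≉b)
          L⊆f[rest] : ∀ {v} → v ∈ L → v ∈ map f rest
          L⊆f[rest] v∈L with All.lookupAny all-hit v∈L
          ... | (t , ft≈z) , v≈z = ∈-resp-≈ setoid (trans ft≈z (sym v≈z)) (f-rest t)

      non-injective⇒missed-value : ∀ {a b} → ¬ a ≈ b → f a ≈ f b → ∃ λ v → ∀ t → ¬ f t ≈ v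
      non-injective⇒missed-value a≉b fa≈fb with All.all? hit? L
      ... | yes all-hit = ⊥-elim (non-injective⇒not-all-hit a≉b fa≈fb all-hit)
      ... | no ¬all-hit = let (v , v-missed) = Any.satisfied (¬All⇒Any¬ hit? L ¬all-hit) in
                          v , λ t ft≈v → v-missed (t , ft≈v)

module LinearAlgebra (F : FiniteField) where

  open Counting
  open import Level using (0ℓ)
  open import Algebra.Bundles using (CommutativeRing)
  import Algebra.Properties.CommutativeSemigroup as CommutativeSemigroupProperties
  import Data.Nat as ℕ
  import Data.Nat.Properties as ℕ
  open import Data.Nat using (zero; _∸_; _^_)
  open import Data.Fin using (Fin; zero; suc)
  import Data.Fin.Properties as Fin
  open import Data.Vec.Functional using (_∷_)
  open import Data.Vec.Functional.Relation.Binary.Pointwise.Properties as Pointwise using ()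
  import Data.List.Relation.Unary.All as All
  open import Data.Unit using (⊤; tt)
  open import Data.Empty using (⊥-elim)
  open import Data.Product using (∃; ∃₂; _×_; _,_; proj₁; proj₂; uncurry)
  open import Data.Product.Relation.Binary.Pointwise.NonDependent using (_×ₛ_)
  open import Relation.Binary using (Setoid; DecSetoid)
  open import Relation.Binary.PropositionalEquality as ≡ using (_≡_)
  open import Relation.Nullary using (¬_; Dec; yes; no; ¬?)
  open import Relation.Nullary.Decidable using (decidable-stable; _×-dec_)
  open import Data.List.Membership.Setoid.Properties using (∈-length)

  open FiniteField F renaming (ring to R)
  open CommutativeRing R hiding (zero)
  open import Algebra.Properties.Ring ring
  open import Relation.Binary.Reasoning.Setoid setoid
  open CommutativeSemigroupProperties *-commutativeSemigroup using (x∙yz≈y∙xz; xy∙z≈y∙zx)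
  open CommutativeSemigroupProperties +-commutativeSemigroup using () renaming (interchange to +-interchange)

  inv : ∀ x → x ≉ 0# → Carrier
  inv x x≉0 = proj₁ (inverse x x≉0)

  x*x⁻¹≈1 : ∀ {x} (x≉0 : x ≉ 0#) → x * inv x x≉0 ≈ 1#
  x*x⁻¹≈1 {x} x≉0 = proj₂ (inverse x x≉0)

  x⁻¹*x≈1 : ∀ {x} (x≉0 : x ≉ 0#) → inv x x≉0 * x ≈ 1#
  x⁻¹*x≈1 x≉0 = trans (*-comm _ _) (x*x⁻¹≈1 x≉0)

  1≉0 : 1# ≉ 0#
  1≉0 1≈0 = 0≉1 (sym 1≈0)

  x*y≈0⇒y≈0 : ∀ {x y} → x ≉ 0# → x * y ≈ 0# → y ≈ 0#
  x*y≈0⇒y≈0 {x} {y} x≉0 xy≈0 = begin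
    y                      ≈⟨ *-identityˡ y ⟨
    1# * y                 ≈⟨ *-congʳ (x⁻¹*x≈1 x≉0) ⟨
    inv x x≉0 * x * y      ≈⟨ *-assoc _ x y ⟩
    inv x x≉0 * (x * y)    ≈⟨ *-congˡ xy≈0 ⟩
    inv x x≉0 * 0#         ≈⟨ zeroʳ _ ⟩
    0#                     ∎

  *-nonzero : ∀ {x y} → x ≉ 0# → y ≉ 0# → x * y ≉ 0#
  *-nonzero x≉0 y≉0 xy≈0 = y≉0 (x*y≈0⇒y≈0 x≉0 xy≈0)

  rescale : ∀ {a b s t} (s≉0 : s ≉ 0#) → a * s ≈ b * t → a ≈ (t * inv s s≉0) * b
  rescale {a} {b} {s} {t} s≉0 as≈bt = begin
    a                        ≈⟨ *-identityʳ a ⟨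
    a * 1#                   ≈⟨ *-congˡ (x*x⁻¹≈1 s≉0) ⟨
    a * (s * inv s s≉0)      ≈⟨ *-assoc a s _ ⟨
    a * s * inv s s≉0        ≈⟨ *-congʳ as≈bt ⟩
    b * t * inv s s≉0        ≈⟨ *-assoc b t _ ⟩
    b * (t * inv s s≉0)      ≈⟨ *-comm b _ ⟩
    (t * inv s s≉0) * b      ∎

  *-cancelʳ-nonzero : ∀ {a b s} → s ≉ 0# → a * s ≈ b * s → a ≈ b
  *-cancelʳ-nonzero {b = b} s≉0 as≈bs =
    trans (rescale s≉0 as≈bs) (trans (*-congʳ (x*x⁻¹≈1 s≉0)) (*-identityˡ b))

  scalars : Census setoid (λ _ → ⊤) q
  scalars = record
    { members        = elements
    ; length-members = ≡.refl
    ; sound          = All.universal _ elements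
    ; unique         = distinct
    ; complete       = λ {x} _ → complete x
    }

  nonzero-scalars : Census setoid (_≉ 0#) (q ∸ 1)
  nonzero-scalars = census-∁ setoid scalars (_≟ 0#) (λ x≈y x≈0 → trans (sym x≈y) x≈0) (census-≈ setoid 0#)

  scalar-search : ∀ {P : Carrier → Set} → (∀ x → Dec (P x)) → (∀ {x y} → x ≈ y → P x → P y) →
                  Dec (∃ P)
  scalar-search = census-∃? setoid scalars

  Vectors : ℕ → Setoid 0ℓ 0ℓ
  Vectors = Pointwise.setoid setoid

  infix 4 _≋_
  _≋_ : ∀ {k} → Vect F k → Vect F k → Set
  _≋_ {k} = Setoid._≈_ (Vectors k)

  0ᵥ : ∀ {k} → Vect F k
  0ᵥ _ = 0#

  vectors : ∀ k → Census (Vectors k) (λ _ → ⊤) (q ^ k)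
  vectors zero    = census-cong (Vectors 0) (λ _ → tt) (λ _ ()) (census-≈ (Vectors 0) (λ ()))
  vectors (suc k) = census-map (uncurry _∷_) cons-cong cons-injective (λ _ → tt)
    (λ {v} _ → (v zero , λ i → v (suc i)) , (tt , tt) , λ { zero → refl ; (suc i) → refl })
    (census-× scalars (vectors k))
    where
    cons-cong : ∀ {p p′} → Setoid._≈_ (setoid ×ₛ Vectors k) p p′ → uncurry _∷_ p ≋ uncurry _∷_ p′
    cons-cong (a≈a′ , v≋v′) zero    = a≈a′
    cons-cong (a≈a′ , v≋v′) (suc i) = v≋v′ i
    cons-injective : ∀ {p p′} → uncurry _∷_ p ≋ uncurry _∷_ p′ → Setoid._≈_ (setoid ×ₛ Vectors k) p p′
    cons-injective e = e zero , λ i → e (suc i)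

  nonzero-vectors : ∀ k → Census (Vectors k) (NonZeroVec F) (q ^ k ∸ 1)
  nonzero-vectors k = census-cong (Vectors k)
    (λ {v} v≉0 → Fin.¬∀⟶∃¬ k _ (λ i → v i ≟ 0#) v≉0) (λ { (i , vᵢ≉0) v≋0 → vᵢ≉0 (v≋0 i) })
    (census-∁ (Vectors k) (vectors k) (λ v → Fin.all? (λ i → v i ≟ 0#))
      (λ u≋v u≋0 i → trans (sym (u≋v i)) (u≋0 i)) (census-≈ (Vectors k) 0ᵥ))

  sumF-cong : ∀ {k} {f g : Fin k → Carrier} → (∀ i → f i ≈ g i) → sumF F f ≈ sumF F g
  sumF-cong {zero}  f≈g = refl
  sumF-cong {suc k} f≈g = +-cong (f≈g zero) (sumF-cong (λ i → f≈g (suc i)))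

  sumF-zero : ∀ {k} {f : Fin k → Carrier} → (∀ i → f i ≈ 0#) → sumF F f ≈ 0#
  sumF-zero {zero}  _   = refl
  sumF-zero {suc k} f≈0 = trans (+-cong (f≈0 zero) (sumF-zero (λ i → f≈0 (suc i)))) (+-identityˡ 0#)

  sumF-distrib-+ : ∀ {k} (f g : Fin k → Carrier) → sumF F (λ i → f i + g i) ≈ sumF F f + sumF F g
  sumF-distrib-+ {zero}  f g = sym (+-identityˡ 0#)
  sumF-distrib-+ {suc k} f g =
    trans (+-congˡ (sumF-distrib-+ (λ i → f (suc i)) (λ i → g (suc i)))) (+-interchange _ _ _ _)

  *-distribˡ-sumF : ∀ {k} c (f : Fin k → Carrier) → sumF F (λ i → c * f i) ≈ c * sumF F f
  *-distribˡ-sumF {zero}  c f = sym (zeroʳ c)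
  *-distribˡ-sumF {suc k} c f = trans (+-congˡ (*-distribˡ-sumF c (λ i → f (suc i)))) (sym (distribˡ c _ _))

  sumF-comm : ∀ {k l} (f : Fin k → Fin l → Carrier) →
              sumF F (λ i → sumF F (f i)) ≈ sumF F (λ j → sumF F (λ i → f i j))
  sumF-comm {zero} {l} f = sym (sumF-zero {l} (λ _ → refl))
  sumF-comm {suc k} f = trans (+-congˡ (sumF-comm (λ i → f (suc i))))
                              (sym (sumF-distrib-+ (f zero) (λ j → sumF F (λ i → f (suc i) j))))

  infixl 6 _+ᵥ_
  infixr 7 _•ᵥ_
  infixr 7 _·ᵥ_

  _+ᵥ_ : ∀ {k} → Vect F k → Vect F k → Vect F k
  (u +ᵥ v) i = u i + v i

  _•ᵥ_ : ∀ {k} → Carrier → Vect F k → Vect F k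
  (c •ᵥ v) i = c * v i

  unit : ∀ {k} → Fin k → Vect F k
  unit zero    zero    = 1#
  unit zero    (suc _) = 0#
  unit (suc i) zero    = 0#
  unit (suc i) (suc j) = unit i j

  _·ᵥ_ : ∀ {k} → Mat F k → Vect F k → Vect F k
  (M ·ᵥ x) i = rowCol F (M i) x

  rowCol-congˡ : ∀ {k} (ξ : Vect F k) {x x′} → x ≋ x′ → rowCol F ξ x ≈ rowCol F ξ x′
  rowCol-congˡ ξ x≋x′ = sumF-cong (λ i → *-congˡ (x≋x′ i))

  rowCol-congʳ : ∀ {k} (x : Vect F k) {ξ ξ′} → ξ ≋ ξ′ → rowCol F ξ x ≈ rowCol F ξ′ x
  rowCol-congʳ x ξ≋ξ′ = sumF-cong (λ i → *-congʳ (ξ≋ξ′ i))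

  rowCol-+ˡ : ∀ {k} (ξ η x : Vect F k) → rowCol F (ξ +ᵥ η) x ≈ rowCol F ξ x + rowCol F η x
  rowCol-+ˡ ξ η x =
    trans (sumF-cong (λ i → distribʳ (x i) (ξ i) (η i))) (sumF-distrib-+ (λ i → ξ i * x i) (λ i → η i * x i))

  rowCol-•ˡ : ∀ {k} c (ξ x : Vect F k) → rowCol F (c •ᵥ ξ) x ≈ c * rowCol F ξ x
  rowCol-•ˡ c ξ x = trans (sumF-cong (λ i → *-assoc c (ξ i) (x i))) (*-distribˡ-sumF c (λ i → ξ i * x i))

  rowCol-•ʳ : ∀ {k} c (ξ x : Vect F k) → rowCol F ξ (c •ᵥ x) ≈ c * rowCol F ξ x
  rowCol-•ʳ c ξ x = trans (sumF-cong (λ i → x∙yz≈y∙xz (ξ i) c (x i))) (*-distribˡ-sumF c (λ i → ξ i * x i))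

  rowCol-unit : ∀ {k} (i : Fin k) (x : Vect F k) → rowCol F (unit i) x ≈ x i
  rowCol-unit zero    x = trans (+-cong (*-identityˡ (x zero)) (sumF-zero (λ j → zeroˡ (x (suc j)))))
                                (+-identityʳ (x zero))
  rowCol-unit (suc i) x = trans (+-cong (zeroˡ (x zero)) (rowCol-unit i (λ j → x (suc j))))
                                (+-identityˡ (x (suc i)))

  rowCol≉0⇒nonzeroˡ : ∀ {k} (ξ x : Vect F k) → rowCol F ξ x ≉ 0# → NonZeroVec F ξ
  rowCol≉0⇒nonzeroˡ ξ x ξx≉0 with Fin.any? (λ i → ¬? (ξ i ≟ 0#))
  ... | yes ξ≉0 = ξ≉0
  ... | no ¬ξ≉0 = ⊥-elim (ξx≉0 (sumF-zero (λ i → trans (*-congʳ (ξ≈0 i)) (zeroˡ (x i)))))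
    where
    ξ≈0 : ∀ i → ξ i ≈ 0#
    ξ≈0 i = decidable-stable (ξ i ≟ 0#) (λ ξᵢ≉0 → ¬ξ≉0 (i , ξᵢ≉0))

  ·ᵥ-cong : ∀ {k} (M : Mat F k) {x y : Vect F k} → x ≋ y → M ·ᵥ x ≋ M ·ᵥ y
  ·ᵥ-cong M x≋y i = rowCol-congˡ (M i) x≋y

  ·ᵥ-• : ∀ {k} (M : Mat F k) c (x : Vect F k) → M ·ᵥ (c •ᵥ x) ≋ c •ᵥ (M ·ᵥ x)
  ·ᵥ-• M c x i = rowCol-•ʳ c (M i) x

  Tr-outer : ∀ {k} (M : Mat F k) (x ξ : Vect F k) → Tr F (_·ₘ_ F (outer F x ξ) M) ≈ rowCol F ξ (M ·ᵥ x)
  Tr-outer M x ξ = begin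
    sumF F (λ i → sumF F (λ l → x i * ξ l * M l i))    ≈⟨ sumF-comm (λ i l → x i * ξ l * M l i) ⟩
    sumF F (λ l → sumF F (λ i → x i * ξ l * M l i))
      ≈⟨ sumF-cong (λ l → sumF-cong (λ i → xy∙z≈y∙zx (x i) (ξ l) (M l i))) ⟩
    sumF F (λ l → sumF F (λ i → ξ l * (M l i * x i)))
      ≈⟨ sumF-cong (λ l → *-distribˡ-sumF (ξ l) (λ i → M l i * x i)) ⟩
    sumF F (λ l → ξ l * (M ·ᵥ x) l)                    ∎

  Tr-cong : ∀ {k} (M : Mat F k) {X Y : Mat F k} → _≈ₘ_ F X Y → Tr F (_·ₘ_ F X M) ≈ Tr F (_·ₘ_ F Y M)
  Tr-cong M X≈Y = sumF-cong (λ i → sumF-cong (λ l → *-congʳ (X≈Y i l)))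

  instance
    q-nonZero : ℕ.NonZero q
    q-nonZero = ℕ.>-nonZero (∈-length setoid (complete 0#))

    q∸1-nonZero : ℕ.NonZero (q ∸ 1)
    q∸1-nonZero = ℕ.>-nonZero (≡.subst (0 ℕ.<_) (Census.length-members nonzero-scalars)
      (∈-length setoid (Census.complete nonzero-scalars 1≉0)))

  -- Translation by c •ᵥ η carries the fibre of ξ ↦ ξy over 0 within U onto the fibre over c.
  module _ {k} (y η : Vect F k) (ηy≈1 : rowCol F η y ≈ 1#) (U : Vect F k → Set)
           (U-shift : ∀ c {ξ} → U ξ → U (ξ +ᵥ c •ᵥ η)) where

    Fibre : Carrier → Vect F k → Set
    Fibre c ξ = U ξ × rowCol F ξ y ≈ c

    private
      rowCol-shift : ∀ c ξ → rowCol F (ξ +ᵥ c •ᵥ η) y ≈ rowCol F ξ y + c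
      rowCol-shift c ξ = trans (rowCol-+ˡ ξ (c •ᵥ η) y)
        (+-congˡ (trans (rowCol-•ˡ c η y) (trans (*-congˡ ηy≈1) (*-identityʳ c))))

      unshift : ∀ c a e → a ≈ (a + - c * e) + c * e
      unshift c a e = sym (begin
        (a + - c * e) + c * e    ≈⟨ +-assoc a _ _ ⟩
        a + (- c * e + c * e)    ≈⟨ +-congˡ (+-congʳ (-‿distribˡ-* c e)) ⟨
        a + (- (c * e) + c * e)  ≈⟨ +-congˡ (-‿inverseˡ (c * e)) ⟩
        a + 0#                   ≈⟨ +-identityʳ a ⟩
        a                        ∎)

      fibre-census : ∀ {s} → Census (Vectors k) (Fibre 0#) s → ∀ c → Census (Vectors k) (Fibre c) s
      fibre-census census₀ c = census-map (λ ξ → ξ +ᵥ c •ᵥ η)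
        (λ ξ≋ξ′ i → +-congʳ (ξ≋ξ′ i)) (λ e i → +-cancelʳ (c * η i) _ _ (e i))
        (λ {ξ} (Uξ , ξy≈0) → U-shift c Uξ , trans (rowCol-shift c ξ) (trans (+-congʳ ξy≈0) (+-identityˡ c)))
        (λ {ξ} (Uξ , ξy≈c) → ξ +ᵥ (- c) •ᵥ η ,
          (U-shift (- c) Uξ , trans (rowCol-shift (- c) ξ) (trans (+-congʳ ξy≈c) (-‿inverseʳ c))) ,
          λ i → unshift c (ξ i) (η i))
        census₀

    shift-invariant-census : ∀ {s} → Census (Vectors k) (Fibre 0#) s → Census (Vectors k) U (q ℕ.* s)
    shift-invariant-census census₀ =
      census-Σ-const (λ ξ → rowCol F ξ y) (rowCol-congʳ y) (λ _ → tt) (λ {c} _ → fibre-census census₀ c) scalars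

    shift-invariant-∖-census : ∀ {s} → Census (Vectors k) (Fibre 0#) s →
                               Census (Vectors k) (λ ξ → U ξ × rowCol F ξ y ≉ 0#) ((q ∸ 1) ℕ.* s)
    shift-invariant-∖-census census₀ =
      census-Σ-const (λ ξ → rowCol F ξ y) (rowCol-congʳ y) proj₂
        (λ {c} c≉0 → census-cong (Vectors k)
          (λ (Uξ , ξy≈c) → (Uξ , λ ξy≈0 → c≉0 (trans (sym ξy≈c) ξy≈0)) , ξy≈c)
          (λ ((Uξ , _) , ξy≈c) → Uξ , ξy≈c)
          (fibre-census census₀ c))
        nonzero-scalars

  module _ {m} {x y : Vect F (suc (suc m))} {i j} (D≉0 : x i * y j - x j * y i ≉ 0#) where

    private
      k : ℕ
      k = suc (suc m)

      D D⁻¹ : Carrier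
      D   = x i * y j - x j * y i
      D⁻¹ = inv D D≉0

      rowCol-combination : ∀ a b z →
                           rowCol F (D⁻¹ •ᵥ (a •ᵥ unit i +ᵥ b •ᵥ unit j)) z ≈ D⁻¹ * (a * z i + b * z j)
      rowCol-combination a b z = trans (rowCol-•ˡ D⁻¹ (a •ᵥ unit i +ᵥ b •ᵥ unit j) z)
        (*-congˡ (trans (rowCol-+ˡ (a •ᵥ unit i) (b •ᵥ unit j) z)
        (+-cong (trans (rowCol-•ˡ a (unit i) z) (*-congˡ (rowCol-unit i z)))
                (trans (rowCol-•ˡ b (unit j) z) (*-congˡ (rowCol-unit j z))))))

      η₁ η₂ : Vect F k
      η₁ = D⁻¹ •ᵥ (y j •ᵥ unit i +ᵥ (- y i) •ᵥ unit j)
      η₂ = D⁻¹ •ᵥ ((- x j) •ᵥ unit i +ᵥ x i •ᵥ unit j)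

      η₁x≈1 : rowCol F η₁ x ≈ 1#
      η₁x≈1 = trans (rowCol-combination (y j) (- y i) x) (trans (*-congˡ ≈D) (x⁻¹*x≈1 D≉0))
        where
        ≈D : y j * x i + - y i * x j ≈ D
        ≈D = +-cong (*-comm (y j) (x i)) (trans (sym (-‿distribˡ-* (y i) (x j))) (-‿cong (*-comm (y i) (x j))))

      η₂x≈0 : rowCol F η₂ x ≈ 0#
      η₂x≈0 = trans (rowCol-combination (- x j) (x i) x) (trans (*-congˡ ≈0) (zeroʳ D⁻¹))
        where
        ≈0 : - x j * x i + x i * x j ≈ 0#
        ≈0 = trans (+-cong (sym (-‿distribˡ-* (x j) (x i))) (*-comm (x i) (x j))) (-‿inverseˡ (x j * x i))

      η₂y≈1 : rowCol F η₂ y ≈ 1#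
      η₂y≈1 = trans (rowCol-combination (- x j) (x i) y) (trans (*-congˡ ≈D) (x⁻¹*x≈1 D≉0))
        where
        ≈D : - x j * y i + x i * y j ≈ D
        ≈D = trans (+-comm _ _) (+-congˡ (sym (-‿distribˡ-* (x j) (y i))))

      x⊥ : Vect F k → Set
      x⊥ ξ = rowCol F ξ x ≈ 0#

      x⊥-shift : ∀ c {ξ} → x⊥ ξ → x⊥ (ξ +ᵥ c •ᵥ η₂)
      x⊥-shift c {ξ} ξx≈0 = trans (rowCol-+ˡ ξ (c •ᵥ η₂) x)
        (trans (+-cong ξx≈0 (trans (rowCol-•ˡ c η₂ x) (trans (*-congˡ η₂x≈0) (zeroʳ c)))) (+-identityˡ 0#))

      x⊥-census : ∃ (Census (Vectors k) x⊥)
      x⊥-census = census-filter (Vectors k) (vectors k) (λ ξ → rowCol F ξ x ≟ 0#)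
        (λ ξ≋ξ′ ξx≈0 → trans (sym (rowCol-congʳ x ξ≋ξ′)) ξx≈0)

      x⊥∩y⊥-census : ∃ (Census (Vectors k) (λ ξ → x⊥ ξ × rowCol F ξ y ≈ 0#))
      x⊥∩y⊥-census = census-filter (Vectors k) (vectors k)
        (λ ξ → (rowCol F ξ x ≟ 0#) ×-dec (rowCol F ξ y ≟ 0#))
        (λ ξ≋ξ′ (ξx≈0 , ξy≈0) →
           trans (sym (rowCol-congʳ x ξ≋ξ′)) ξx≈0 , trans (sym (rowCol-congʳ y ξ≋ξ′)) ξy≈0)

      s₁ s₂ : ℕ
      s₁ = proj₁ x⊥-census
      s₂ = proj₁ x⊥∩y⊥-census

      q*s₁≡q^k : q ℕ.* s₁ ≡ q ^ k
      q*s₁≡q^k = census-unique (Vectors k)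
        (shift-invariant-census x η₁ η₁x≈1 (λ _ → ⊤) (λ _ _ → tt)
          (census-cong (Vectors k) (λ x⊥ξ → tt , x⊥ξ) proj₂ (proj₂ x⊥-census)))
        (vectors k)

      q*s₂≡s₁ : q ℕ.* s₂ ≡ s₁
      q*s₂≡s₁ = census-unique (Vectors k)
        (shift-invariant-census y η₂ η₂y≈1 x⊥ x⊥-shift (proj₂ x⊥∩y⊥-census)) (proj₂ x⊥-census)

      s₂≡q^m : s₂ ≡ q ^ m
      s₂≡q^m = ℕ.*-cancelˡ-≡ s₂ (q ^ m) q (ℕ.*-cancelˡ-≡ (q ℕ.* s₂) (q ℕ.* q ^ m) q
        (≡.trans (≡.cong (q ℕ.*_) q*s₂≡s₁) q*s₁≡q^k))

    x⊥∖y⊥-census : Census (Vectors k) (λ ξ → rowCol F ξ x ≈ 0# × rowCol F ξ y ≉ 0#) ((q ∸ 1) ℕ.* q ^ m)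
    x⊥∖y⊥-census =
      ≡.subst (λ s → Census (Vectors k) (λ ξ → x⊥ ξ × rowCol F ξ y ≉ 0#) ((q ∸ 1) ℕ.* s)) s₂≡q^m
      (shift-invariant-∖-census y η₂ η₂y≈1 x⊥ x⊥-shift (proj₂ x⊥∩y⊥-census))

  infix 4 _∝_ _∝?_
  _∝_ : ∀ {k} → Vect F k → Vect F k → Set
  y ∝ x = ∃ λ t → y ≋ t •ᵥ x

  _∝?_ : ∀ {k} (y x : Vect F k) → Dec (y ∝ x)
  y ∝? x = scalar-search (λ t → Fin.all? (λ i → y i ≟ (t * x i)))
                         (λ s≈t y≋sx i → trans (y≋sx i) (*-congʳ s≈t))

  ∝-resp-≋ : ∀ {k} {x x′ y y′ : Vect F k} → x ≋ x′ → y ≋ y′ → y ∝ x → y′ ∝ x′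
  ∝-resp-≋ x≋x′ y≋y′ (t , y≋tx) = t , λ i → trans (sym (y≋y′ i)) (trans (y≋tx i) (*-congˡ (x≋x′ i)))

  ¬∝⇒minor≉0 : ∀ {k} {x y : Vect F k} {i} → x i ≉ 0# → ¬ (y ∝ x) → ∃ λ j → x i * y j - x j * y i ≉ 0#
  ¬∝⇒minor≉0 {x = x} {y} {i} xᵢ≉0 y∝̸x with Fin.any? (λ j → ¬? ((x i * y j - x j * y i) ≟ 0#))
  ... | yes minor≉0 = minor≉0
  ... | no ¬minor≉0 = ⊥-elim (y∝̸x (y i * inv (x i) xᵢ≉0 , λ j → rescale xᵢ≉0 (yⱼxᵢ≈xⱼyᵢ j)))
    where
    yⱼxᵢ≈xⱼyᵢ : ∀ j → y j * x i ≈ x j * y i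
    yⱼxᵢ≈xⱼyᵢ j = trans (*-comm (y j) (x i))
      (x∙y⁻¹≈ε⇒x≈y _ _ (decidable-stable (_ ≟ 0#) (λ minor≉0 → ¬minor≉0 (j , minor≉0))))

  inv-nonzero : ∀ {x} (x≉0 : x ≉ 0#) → inv x x≉0 ≉ 0#
  inv-nonzero {x} x≉0 x⁻¹≈0 = 1≉0 (trans (sym (x⁻¹*x≈1 x≉0)) (trans (*-congʳ x⁻¹≈0) (zeroˡ x)))

  Points : ℕ → DecSetoid 0ℓ 0ℓ
  Points k = record
    { Carrier          = Mat F k
    ; _≈_              = SamePoint F
    ; isDecEquivalence = record
      { isEquivalence = record { refl = same-refl ; sym = same-sym ; trans = same-trans }
      ; _≟_           = same? } }
    where
    same-refl : ∀ {X} → SamePoint F X X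
    same-refl = 1# , 1≉0 , λ i j → sym (*-identityˡ _)
    same-sym : ∀ {X Y} → SamePoint F X Y → SamePoint F Y X
    same-sym {X} {Y} (c , c≉0 , X≈cY) = inv c c≉0 , inv-nonzero c≉0 , λ i j → begin
      Y i j                     ≈⟨ *-identityˡ (Y i j) ⟨
      1# * Y i j                ≈⟨ *-congʳ (x⁻¹*x≈1 c≉0) ⟨
      inv c c≉0 * c * Y i j     ≈⟨ *-assoc _ c (Y i j) ⟩
      inv c c≉0 * (c * Y i j)   ≈⟨ *-congˡ (X≈cY i j) ⟨
      inv c c≉0 * X i j         ∎
    same-trans : ∀ {X Y Z} → SamePoint F X Y → SamePoint F Y Z → SamePoint F X Z
    same-trans (c , c≉0 , X≈cY) (d , d≉0 , Y≈dZ) =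
      c * d , *-nonzero c≉0 d≉0 , λ i j → trans (X≈cY i j) (trans (*-congˡ (Y≈dZ i j)) (sym (*-assoc c d _)))
    same? : ∀ X Y → Dec (SamePoint F X Y)
    same? X Y = scalar-search
      (λ c → ¬? (c ≟ 0#) ×-dec Fin.all? (λ i → Fin.all? (λ j → X i j ≟ (c * Y i j))))
      (λ c≈d (c≉0 , X≈cY) → (λ d≈0 → c≉0 (trans c≈d d≈0)) , λ i j → trans (X≈cY i j) (*-congʳ c≈d))

  outer-factors : ∀ {k} {x ξ y η : Vect F k} {c} → NonZeroVec F x → NonZeroVec F ξ →
                  _≈ₘ_ F (outer F x ξ) (_•ₘ_ F c (outer F y η)) →
                  ∃₂ λ α β → α ≉ 0# × β ≉ 0# × x ≋ α •ᵥ y × ξ ≋ β •ᵥ η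
  outer-factors {x = x} {ξ} {y} {η} {c} (i₁ , xᵢ≉0) (j₁ , ξⱼ≉0) xξ≈cyη =
    α , β , α≉0 , β≉0 , x≋αy , ξ≋βη
    where
    α β : Carrier
    α = (c * η j₁) * inv (ξ j₁) ξⱼ≉0
    β = (c * y i₁) * inv (x i₁) xᵢ≉0
    x≋αy : x ≋ α •ᵥ y
    x≋αy i = rescale ξⱼ≉0 (trans (xξ≈cyη i j₁) (x∙yz≈y∙xz c (y i) (η j₁)))
    ξ≋βη : ξ ≋ β •ᵥ η
    ξ≋βη j = rescale xᵢ≉0 (trans (*-comm (ξ j) (x i₁))
      (trans (xξ≈cyη i₁ j) (trans (sym (*-assoc c (y i₁) (η j))) (*-comm _ (η j)))))
    α≉0 : α ≉ 0#
    α≉0 α≈0 = xᵢ≉0 (trans (x≋αy i₁) (trans (*-congʳ α≈0) (zeroˡ _)))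
    β≉0 : β ≉ 0#
    β≉0 β≈0 = ξⱼ≉0 (trans (ξ≋βη j₁) (trans (*-congʳ β≈0) (zeroˡ _)))

module CodewordWeight (F : FiniteField) {m : ℕ} (M : Mat F (suc (suc m))) where

  open Counting
  open LinearAlgebra F
  open import Level using (0ℓ)
  open import Algebra.Bundles using (CommutativeRing)
  import Algebra.Properties.CommutativeSemigroup as CommutativeSemigroupProperties
  import Data.Nat as ℕ
  import Data.Nat.Properties as ℕ
  open import Data.Nat using (_∸_; _^_)
  open import Data.Nat.ListAction using (sum)
  open import Data.Nat.Tactic.RingSolver using (solve-∀)
  open import Data.Bool using (if_then_else_; true; false)
  open import Data.Product as Product using (∃; _×_; _,_; proj₁; proj₂)
  open import Data.Product.Relation.Binary.Pointwise.NonDependent using (_×ₛ_)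
  open import Data.List using (List; length; map)
  import Data.List.Relation.Unary.All as All
  import Data.List.Relation.Unary.All.Properties as All
  import Data.List.Membership.Setoid as Membership
  open import Data.List.Membership.Setoid.Properties using (∈-map⁺; ∈-resp-≈)
  open import Function.Bundles using (_⇔_; mk⇔)
  open import Relation.Binary using (Setoid; DecSetoid)
  import Relation.Binary.Reasoning.Setoid as SetoidReasoning
  open import Relation.Binary.PropositionalEquality as ≡ using (_≡_)
  open import Relation.Nullary using (¬_; yes; no; does)
  open import Relation.Nullary.Decidable using (dec-true; dec-false)

  open FiniteField F renaming (ring to R)
  open CommutativeRing R hiding (zero)
  open Census
  open CommutativeSemigroupProperties *-commutativeSemigroup using () renaming (interchange to *-interchange)

  k : ℕ
  k = suc (suc m)

  Pairs : Setoid 0ℓ 0ℓ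
  Pairs = Vectors k ×ₛ Vectors k

  outerₚ : Vect F k × Vect F k → Mat F k
  outerₚ (x , ξ) = outer F x ξ

  SupportPair : Vect F k × Vect F k → Set
  SupportPair (x , ξ) = NonZeroVec F x × rowCol F ξ x ≈ 0# × rowCol F ξ (M ·ᵥ x) ≉ 0#

  Support : Mat F k → Set
  Support X = NonZeroMat F X × InΛ₁ F X × NonZeroCoord F M X

  support-pair⇒support : ∀ {p} → SupportPair p → Support (outerₚ p)
  support-pair⇒support {x , ξ} ((i , xᵢ≉0) , ξx≈0 , ξMx≉0) with rowCol≉0⇒nonzeroˡ ξ (M ·ᵥ x) ξMx≉0
  ... | j , ξⱼ≉0 =
    (i , j , *-nonzero xᵢ≉0 ξⱼ≉0) , (x , ξ , (i , xᵢ≉0) , (j , ξⱼ≉0) , ξx≈0 , λ _ _ → refl) ,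
    λ tr≈0 → ξMx≉0 (trans (sym (Tr-outer M x ξ)) tr≈0)

  support⇒support-pair : ∀ {X} → Support X → ∃ λ p → SupportPair p × _≈ₘ_ F X (outerₚ p)
  support⇒support-pair {X} (_ , (x , ξ , x≉0 , _ , ξx≈0 , X≈xξ) , XM≉0) =
    (x , ξ) , (x≉0 , ξx≈0 , λ ξMx≈0 → XM≉0 (trans (Tr-cong M X≈xξ) (trans (Tr-outer M x ξ) ξMx≈0))) ,
    X≈xξ

  outer-cong : ∀ {p p′} → Setoid._≈_ Pairs p p′ → SamePoint F (outerₚ p) (outerₚ p′)
  outer-cong (x≋x′ , ξ≋ξ′) = 1# , 1≉0 , λ i j → trans (*-cong (x≋x′ i) (ξ≋ξ′ j)) (sym (*-identityˡ _))

  pairs-over-point : ∀ {X} → Support X →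
    Census Pairs (λ p → SupportPair p × SamePoint F (outerₚ p) X) ((q ∸ 1) ℕ.* (q ∸ 1))
  pairs-over-point {X} X∈supp with support⇒support-pair X∈supp
  ... | (x₀ , ξ₀) , ((i₀ , x₀ᵢ≉0) , ξ₀x₀≈0 , ξ₀Mx₀≉0) , X≈x₀ξ₀
    with rowCol≉0⇒nonzeroˡ ξ₀ (M ·ᵥ x₀) ξ₀Mx₀≉0
  ... | j₀ , ξ₀ⱼ≉0 = census-map scale
    (λ (α≈α′ , β≈β′) → (λ _ → *-congʳ α≈α′) , (λ _ → *-congʳ β≈β′))
    (λ (αx₀≋α′x₀ , βξ₀≋β′ξ₀) →
       *-cancelʳ-nonzero x₀ᵢ≉0 (αx₀≋α′x₀ i₀) , *-cancelʳ-nonzero ξ₀ⱼ≉0 (βξ₀≋β′ξ₀ j₀))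
    scaled unscaled (census-× nonzero-scalars nonzero-scalars)
    where
    scale : Carrier × Carrier → Vect F k × Vect F k
    scale (α , β) = α •ᵥ x₀ , β •ᵥ ξ₀

    scaled : ∀ {αβ} → proj₁ αβ ≉ 0# × proj₂ αβ ≉ 0# →
             SupportPair (scale αβ) × SamePoint F (outerₚ (scale αβ)) X
    scaled {α , β} (α≉0 , β≉0) =
      ((i₀ , *-nonzero α≉0 x₀ᵢ≉0) , ξx≈0 ,
       λ ξMx≈0 → *-nonzero β≉0 (*-nonzero α≉0 ξ₀Mx₀≉0) (trans (sym ξMx≈) ξMx≈0)) ,
      (α * β , *-nonzero α≉0 β≉0 ,
       λ i j → trans (*-interchange α (x₀ i) β (ξ₀ j)) (*-congˡ (sym (X≈x₀ξ₀ i j))))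
      where
      ξx≈0 : rowCol F (β •ᵥ ξ₀) (α •ᵥ x₀) ≈ 0#
      ξx≈0 = trans (rowCol-•ˡ β ξ₀ (α •ᵥ x₀))
        (trans (*-congˡ (trans (rowCol-•ʳ α ξ₀ x₀) (trans (*-congˡ ξ₀x₀≈0) (zeroʳ α)))) (zeroʳ β))
      ξMx≈ : rowCol F (β •ᵥ ξ₀) (M ·ᵥ α •ᵥ x₀) ≈ β * (α * rowCol F ξ₀ (M ·ᵥ x₀))
      ξMx≈ = trans (rowCol-•ˡ β ξ₀ (M ·ᵥ α •ᵥ x₀))
        (*-congˡ (trans (rowCol-congˡ ξ₀ (·ᵥ-• M α x₀)) (rowCol-•ʳ α ξ₀ (M ·ᵥ x₀))))

    unscaled : ∀ {p} → SupportPair p × SamePoint F (outerₚ p) X →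
               ∃ λ αβ → (proj₁ αβ ≉ 0# × proj₂ αβ ≉ 0#) × Setoid._≈_ Pairs p (scale αβ)
    unscaled {x , ξ} ((x≉0 , _ , ξMx≉0) , c , _ , xξ≈cX)
      with outer-factors x≉0 (rowCol≉0⇒nonzeroˡ ξ (M ·ᵥ x) ξMx≉0)
                         (λ i j → trans (xξ≈cX i j) (*-congˡ (X≈x₀ξ₀ i j)))
    ... | α , β , α≉0 , β≉0 , x≋αx₀ , ξ≋βξ₀ = (α , β) , (α≉0 , β≉0) , (x≋αx₀ , ξ≋βξ₀)

  ξ-max : ℕ
  ξ-max = (q ∸ 1) ℕ.* q ^ m

  instance
    ξ-max-nonZero : ℕ.NonZero ξ-max
    ξ-max-nonZero = ℕ.m*n≢0 (q ∸ 1) (q ^ m) {{q∸1-nonZero}} {{ℕ.m^n≢0 q m}}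

  ξ-count : Vect F k → ℕ
  ξ-count x = if does (M ·ᵥ x ∝? x) then 0 else ξ-max

  ∝⇒annihilated : ∀ {x} ξ → M ·ᵥ x ∝ x → rowCol F ξ x ≈ 0# → rowCol F ξ (M ·ᵥ x) ≈ 0#
  ∝⇒annihilated {x} ξ (t , Mx≋tx) ξx≈0 = begin
    rowCol F ξ (M ·ᵥ x)     ≈⟨ rowCol-congˡ ξ Mx≋tx ⟩
    rowCol F ξ (t •ᵥ x)     ≈⟨ rowCol-•ʳ t ξ x ⟩
    t * rowCol F ξ x        ≈⟨ *-congˡ ξx≈0 ⟩
    t * 0#                  ≈⟨ zeroʳ t ⟩
    0#                      ∎
    where open SetoidReasoning setoid

  pairs-over-vector : ∀ {x} → NonZeroVec F x → Census Pairs (λ p → SupportPair p × proj₁ p ≋ x) (ξ-count x)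
  pairs-over-vector {x} (i , xᵢ≉0) with M ·ᵥ x ∝? x
  ... | yes Mx∝x = census-∅ Pairs λ { {x′ , ξ} ((_ , ξx′≈0 , ξMx′≉0) , x′≋x) →
    ξMx′≉0 (∝⇒annihilated ξ (∝-resp-≋ (λ i → sym (x′≋x i)) (·ᵥ-cong M (λ i → sym (x′≋x i))) Mx∝x)
                            ξx′≈0) }
  ... | no Mx∝̸x with ¬∝⇒minor≉0 {y = M ·ᵥ x} xᵢ≉0 Mx∝̸x
  ... | j , minor≉0 = census-map (x ,_) ((λ _ → refl) ,_) proj₂
    (λ (ξx≈0 , ξMx≉0) → ((i , xᵢ≉0) , ξx≈0 , ξMx≉0) , λ _ → refl)
    (λ { {x′ , ξ} ((_ , ξx′≈0 , ξMx′≉0) , x′≋x) →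
           ξ , (trans (sym (rowCol-congˡ ξ x′≋x)) ξx′≈0 ,
                λ ξMx≈0 → ξMx′≉0 (trans (rowCol-congˡ ξ (·ᵥ-cong M x′≋x)) ξMx≈0)) ,
           x′≋x , λ _ → refl })
    (x⊥∖y⊥-census {x = x} {y = M ·ᵥ x} minor≉0)

  support-pairs : Census Pairs SupportPair (sum (map ξ-count (members (nonzero-vectors k))))
  support-pairs = census-Σ proj₁ proj₁ proj₁ pairs-over-vector (nonzero-vectors k)

  PointsSetoid : Setoid 0ℓ 0ℓ
  PointsSetoid = DecSetoid.setoid (Points k)

  weight⇒census : ∀ {w} → Weight F M w → Census PointsSetoid Support w
  weight⇒census (L , |L|≡w , supp , distinct , cover) = record
    { members = L ; length-members = |L|≡w ; sound = supp ; unique = distinct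
    ; complete = λ (X≉0 , X∈Λ₁ , XM≉0) → cover _ X≉0 X∈Λ₁ XM≉0 }

  census⇒weight : ∀ {w} → Census PointsSetoid Support w → Weight F M w
  census⇒weight c =
    members c , length-members c , sound c , unique c , λ _ X≉0 X∈Λ₁ XM≉0 → complete c (X≉0 , X∈Λ₁ , XM≉0)

  weight-equation : ∀ {w} → Weight F M w →
                    w ℕ.* ((q ∸ 1) ℕ.* (q ∸ 1)) ≡ sum (map ξ-count (members (nonzero-vectors k)))
  weight-equation wt = census-unique Pairs
    (census-Σ-const outerₚ outer-cong support-pair⇒support pairs-over-point (weight⇒census wt)) support-pairs

  weight-exists : ∃ (Weight F M)
  weight-exists = Product.map₂ census⇒weight
    (census-deduplicate (Points k) (map outerₚ (members support-pairs))
      (All.map⁺ (All.map support-pair⇒support (sound support-pairs))) covered)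
    where
    open Membership PointsSetoid using (_∈_)
    covered : ∀ {X} → Support X → X ∈ map outerₚ (members support-pairs)
    covered X∈supp =
      let p , p∈supp , X≈outer-p = support⇒support-pair X∈supp in
      ∈-resp-≈ PointsSetoid (1# , 1≉0 , λ i j → trans (sym (X≈outer-p i j)) (sym (*-identityˡ _)))
        (∈-map⁺ Pairs PointsSetoid outer-cong (complete support-pairs p∈supp))

  private
    nonzeros : List (Vect F k)
    nonzeros = members (nonzero-vectors k)

  ξ-count≤ξ-max : ∀ x → ξ-count x ℕ.≤ ξ-max
  ξ-count≤ξ-max x with does (M ·ᵥ x ∝? x)
  ... | true  = ℕ.z≤n
  ... | false = ℕ.≤-refl

  ξ-count-∝ : ∀ {x} → M ·ᵥ x ∝ x → ξ-count x ≡ 0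
  ξ-count-∝ {x} Mx∝x = ≡.cong (if_then 0 else ξ-max) (dec-true (M ·ᵥ x ∝? x) Mx∝x)

  ξ-count-∝̸ : ∀ {x} → ¬ (M ·ᵥ x ∝ x) → ξ-count x ≡ ξ-max
  ξ-count-∝̸ {x} Mx∝̸x = ≡.cong (if_then 0 else ξ-max) (dec-false (M ·ᵥ x ∝? x) Mx∝̸x)

  W : ℕ
  W = q ^ m ℕ.* (q ^ k ∸ 1)

  weight-sum : ∀ {w} → Weight F M w → w ℕ.* (q ∸ 1) ℕ.* (q ∸ 1) ≡ sum (map ξ-count nonzeros)
  weight-sum {w} wt = ≡.trans (ℕ.*-assoc w (q ∸ 1) (q ∸ 1)) (weight-equation wt)

  maximal-sum : length nonzeros ℕ.* ξ-max ≡ W ℕ.* (q ∸ 1)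
  maximal-sum = ≡.trans (≡.cong (ℕ._* ξ-max) (length-members (nonzero-vectors k)))
                        (rearrange (q ^ k ∸ 1) (q ∸ 1) (q ^ m))
    where
    rearrange : ∀ N a Q → N ℕ.* (a ℕ.* Q) ≡ Q ℕ.* N ℕ.* a
    rearrange = solve-∀

  weight-bound : ∀ {w} → Weight F M w → w ℕ.* (q ∸ 1) ℕ.≤ W
  weight-bound {w} wt = ℕ.*-cancelʳ-≤ (w ℕ.* (q ∸ 1)) W (q ∸ 1) (begin
    w ℕ.* (q ∸ 1) ℕ.* (q ∸ 1)  ≡⟨ weight-sum wt ⟩
    sum (map ξ-count nonzeros)      ≤⟨ sum-map-≤ ξ-count≤ξ-max nonzeros ⟩
    length nonzeros ℕ.* ξ-max             ≡⟨ maximal-sum ⟩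
    W ℕ.* (q ∸ 1)               ∎)
    where open ℕ.≤-Reasoning

  weight-max⇔no-eigenvalue : ∀ {w} → Weight F M w → (w ℕ.* (q ∸ 1) ≡ W) ⇔ (¬ HasEigenvalue F M)
  weight-max⇔no-eigenvalue {w} wt = mk⇔ to from
    where
    to : w ℕ.* (q ∸ 1) ≡ W → ¬ HasEigenvalue F M
    to w*[q-1]≡W (t , v , v≉0 , Mv≋tv) =
      let u , (u-size≡ξ-max , v≋u) = lookup-all-max (complete (nonzero-vectors k) v≉0) in
      ℕ.≢-nonZero⁻¹ ξ-max
        (≡.trans (≡.sym u-size≡ξ-max) (ξ-count-∝ (∝-resp-≋ v≋u (·ᵥ-cong M v≋u) (t , Mv≋tv))))
      where
      all-max : All.All (λ x → ξ-count x ≡ ξ-max) nonzeros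
      all-max = sum-map-≡⇒All ξ-count≤ξ-max nonzeros (≡.trans (≡.sym (weight-sum wt))
                  (≡.trans (≡.cong (ℕ._* (q ∸ 1)) w*[q-1]≡W) (≡.sym maximal-sum)))
      lookup-all-max : ∀ {v} → Membership._∈_ (Vectors k) v nonzeros → ∃ λ u → ξ-count u ≡ ξ-max × v ≋ u
      lookup-all-max v∈nonzeros = _ , All.lookupAny all-max v∈nonzeros
    from : ¬ HasEigenvalue F M → w ℕ.* (q ∸ 1) ≡ W
    from no-eigenvalue = ℕ.*-cancelʳ-≡ (w ℕ.* (q ∸ 1)) W (q ∸ 1)
      (≡.trans (weight-sum wt) (≡.trans (All⇒sum-map-≡ nonzeros all-max) maximal-sum))
      where
      all-max : All.All (λ x → ξ-count x ≡ ξ-max) nonzeros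
      all-max = All.map (λ {x} x≉0 → ξ-count-∝̸ (λ (t , Mx≋tx) → no-eigenvalue (t , x , x≉0 , Mx≋tx)))
                  (sound (nonzero-vectors k))

module CompanionMatrix (F : FiniteField) (m : ℕ) where

  open Counting
  open LinearAlgebra F
  open import Level using (0ℓ)
  open import Algebra.Bundles using (CommutativeRing; Semiring)
  open import Data.Nat using (zero)
  open import Data.Fin using (Fin; zero; suc; toℕ; inject₁; fromℕ)
  import Data.Fin.Properties as Fin
  open import Data.Fin.Relation.Unary.Top using (View; view; ‵fromℕ; ‵inj₁; view-inject₁; view-fromℕ)
  open import Data.Product using (∃; _,_; proj₁; proj₂)
  open import Relation.Binary using (DecSetoid)
  open import Relation.Binary.PropositionalEquality as ≡ using (_≡_)
  open import Relation.Nullary using (¬_)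

  open FiniteField F renaming (ring to R)
  open CommutativeRing R hiding (zero)
  open import Algebra.Properties.Ring ring using (-0#≈0#; [y-z]x≈yx-zx; xyx⁻¹≈y)
  open import Algebra.Definitions.RawSemiring (Semiring.rawSemiring semiring) using (_^_)
  open import Algebra.Properties.Semiring.Exp semiring using (^-congˡ)
  open import Relation.Binary.Reasoning.Setoid setoid

  geometric : ∀ {n t} (x : Fin (suc n) → Carrier) → (∀ i → x (suc i) ≈ t * x (inject₁ i)) →
              ∀ i → x i ≈ t ^ toℕ i * x zero
  geometric         x step zero    = sym (*-identityˡ (x zero))
  geometric {suc n} {t} x step (suc i) = begin
    x (suc i)                             ≈⟨ step i ⟩
    t * x (inject₁ i)                     ≈⟨ *-congˡ (geometric (λ j → x (inject₁ j)) (λ j → step (inject₁ j)) i) ⟩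
    t * (t ^ toℕ i * x zero)              ≈⟨ *-assoc t _ _ ⟨
    t ^ suc (toℕ i) * x zero              ∎

  k : ℕ
  k = suc (suc m)

  lastRow : Carrier → Vect F k
  lastRow c zero          = c
  lastRow c (suc zero)    = 1#
  lastRow c (suc (suc _)) = 0#

  -- The companion matrix of t^k - t - c: row i < k - 1 is the unit row e_(i+1), the last
  -- row is (c, 1, 0, …, 0).
  companionRow : Carrier → {i : Fin k} → View i → Vect F k
  companionRow c ‵fromℕ            = lastRow c
  companionRow c (‵inj₁ {i = i} _) = unit (suc i)

  companion : Carrier → Mat F k
  companion c i = companionRow c (view i)

  companion-inject₁ : ∀ c i x → (companion c ·ᵥ x) (inject₁ i) ≈ x (suc i)
  companion-inject₁ c i x rewrite view-inject₁ i = rowCol-unit (suc i) x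

  companion-last : ∀ c x → (companion c ·ᵥ x) (fromℕ (suc m)) ≈ c * x zero + x (suc zero)
  companion-last c x rewrite view-fromℕ (suc m) =
    +-congˡ (trans (+-cong (*-identityˡ (x (suc zero))) (sumF-zero (λ j → zeroˡ (x (suc (suc j))))))
                   (+-identityʳ (x (suc zero))))

  Scalars : DecSetoid 0ℓ 0ℓ
  Scalars = record
    { Carrier = Carrier ; _≈_ = _≈_
    ; isDecEquivalence = record { isEquivalence = isEquivalence ; _≟_ = _≟_ } }

  1^n≈1 : ∀ n → 1# ^ n ≈ 1#
  1^n≈1 zero    = refl
  1^n≈1 (suc n) = trans (*-identityˡ _) (1^n≈1 n)

  missed-value : ∃ λ c → ∀ t → t ^ k - t ≉ c
  missed-value = non-injective⇒missed-value Scalars scalars (λ t → t ^ k - t)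
    (λ {s} {t} s≈t → +-cong (^-congˡ k s≈t) (-‿cong s≈t)) 0≉1 (begin
      0# ^ k - 0#     ≈⟨ +-cong (zeroˡ _) -0#≈0# ⟩
      0# + 0#         ≈⟨ +-identityʳ 0# ⟩
      0#              ≈⟨ -‿inverseʳ 1# ⟨
      1# - 1#         ≈⟨ +-congʳ (1^n≈1 k) ⟨
      1# ^ k - 1#     ∎)

  companion-no-eigenvalue : ¬ HasEigenvalue F (companion (proj₁ missed-value))
  companion-no-eigenvalue (t , x , (i , xᵢ≉0) , Mx≈tx) = proj₂ missed-value t (sym c≈tᵏ-t)
    where
    c : Carrier
    c = proj₁ missed-value

    x≈tⁱx₀ : ∀ i → x i ≈ t ^ toℕ i * x zero
    x≈tⁱx₀ = geometric x (λ i → trans (sym (companion-inject₁ c i x)) (Mx≈tx (inject₁ i)))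

    x₀≉0 : x zero ≉ 0#
    x₀≉0 x₀≈0 = xᵢ≉0 (trans (x≈tⁱx₀ i) (trans (*-congˡ x₀≈0) (zeroʳ _)))

    cx₀+tx₀≈tᵏx₀ : c * x zero + t * x zero ≈ t ^ k * x zero
    cx₀+tx₀≈tᵏx₀ = begin
      c * x zero + t * x zero              ≈⟨ +-congˡ (*-congʳ (*-identityʳ t)) ⟨
      c * x zero + t ^ 1 * x zero          ≈⟨ +-congˡ (x≈tⁱx₀ (suc zero)) ⟨
      c * x zero + x (suc zero)            ≈⟨ companion-last c x ⟨
      (companion c ·ᵥ x) (fromℕ (suc m))   ≈⟨ Mx≈tx (fromℕ (suc m)) ⟩
      t * x (fromℕ (suc m))                ≈⟨ *-congˡ (x≈tⁱx₀ (fromℕ (suc m))) ⟩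
      t * (t ^ toℕ (fromℕ (suc m)) * x zero) ≈⟨ *-congˡ (*-congʳ (reflexive (≡.cong (t ^_) (Fin.toℕ-fromℕ (suc m))))) ⟩
      t * (t ^ suc m * x zero)             ≈⟨ *-assoc t _ _ ⟨
      t ^ k * x zero                       ∎

    c≈tᵏ-t : c ≈ t ^ k - t
    c≈tᵏ-t = *-cancelʳ-nonzero x₀≉0 (begin
      c * x zero                                  ≈⟨ xyx⁻¹≈y (t * x zero) (c * x zero) ⟨
      t * x zero + c * x zero - t * x zero        ≈⟨ +-congʳ (trans (+-comm _ _) cx₀+tx₀≈tᵏx₀) ⟩
      t ^ k * x zero - t * x zero                 ≈⟨ [y-z]x≈yx-zx (x zero) (t ^ k) t ⟨
      (t ^ k - t) * x zero                        ∎)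

open CodewordWeight using (weight-bound; weight-max⇔no-eigenvalue; weight-exists)
open import Data.Nat using (_≤_; _*_; _∸_; _^_)
open import Data.Product using (_×_; ∃; _,_; proj₁; proj₂)
open import Relation.Binary.PropositionalEquality using (_≡_)
open import Relation.Nullary using (¬_)
open import Function.Bundles using (_⇔_; Equivalence)

proposition3p17 : (F : FiniteField) (n : ℕ) → 1 ≤ n →
    let q = FiniteField.q F
        W = q ^ (n ∸ 1) * (q ^ suc n ∸ 1)
    in ((M : Mat F (suc n)) (w : ℕ) → Weight F M w → w * (q ∸ 1) ≤ W)
     × ((M : Mat F (suc n)) (w : ℕ) → Weight F M w →
          ((w * (q ∸ 1) ≡ W) ⇔ (¬ HasEigenvalue F M)))
     × (∃ λ (M : Mat F (suc n)) → ∃ λ (w : ℕ) → Weight F M w × w * (q ∸ 1) ≡ W)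
proposition3p17 F (suc m) _ =
  (λ M _ → weight-bound F M) ,
  (λ M _ → weight-max⇔no-eigenvalue F M) ,
  (M₀ , w , wt , Equivalence.from (weight-max⇔no-eigenvalue F M₀ wt) companion-no-eigenvalue)
  where
  open CompanionMatrix F m using (companion; missed-value; companion-no-eigenvalue)
  M₀ : Mat F (suc (suc m))
  M₀ = companion (proj₁ missed-value)
  w : ℕ
  w = proj₁ (weight-exists F M₀)
  wt : Weight F M₀ w
  wt = proj₂ (weight-exists F M₀)
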